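{- Let $D$ be any digraph, and let $\mathcal{U}$ be a finite set of vertex sets of $D$. Then the following are equivalent: (i) $D$ has an end in the closure of $\mathcal{U}$; (ii) $D$ has a vertex-direction in the closure of $\mathcal{U}$; (iii) $D$ contains a necklace attached to $\mathcal{U}$.
   Context: Digraphs have no loops and no parallel edges, but may contain both $uv$ and $vu$. $\mathcal{X}(D)$ is the set of finite subsets of $V(D)$. A ray is a digraph on distinct vertices $v_0,v_1,\dots$ with edges $v_iv_{i+1}$; its tails are its subrays. A ray $R\subseteq D$ is solid if for every $X\in\mathcal{X}(D)$ some tail of $R$ lies in a single strong component of $D-X$. Two solid rays are equivalent if for every $X\in\mathcal{X}(D)$ they have tails in the same strong component of $D-X$; equivalence classes are the ends of $D$. $C(X,\omega)$ is the strong component of $D-X$ containing a tail of every ray in the end $\omega$. An end $\omega$ is in the closure of $\mathcal{U}$ if $C(X,\omega)$ meets every $U\in\mathcal{U}$ for every $X\in\mathcal{X}(D)$. A vertex-direction is a map $f$ on $\mathcal{X}(D)$ sending each $X$ to a strong component of $D-X$ with $f(X)\supseteq f(Y)$ whenever $X\subseteq Y$; it is in the closure of $\mathcal{U}$ if $f(X)$ meets every $U\in\mathcal{U}$ for every $X\in\mathcal{X}(D)$. An $A$–$B$ path is a directed path meeting $A$ exactly in its first and $B$ exactly in its last vertex. A necklace is a union of pairwise disjoint finite vertex sets $Y_0,Y_1,\dots$ (beads), each spanning a strongly connected digraph $H_i$ on $Y_i$, together with, for each $i$, a $Y_i$–$Y_{i+1}$ path and a $Y_{i+1}$–$Y_i$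 path, all these paths internally disjoint from each other and from all beads. A necklace $N\subseteq D$ is attached to $\mathcal{U}$ if infinitely many of its beads each meet every set in $\mathcal{U}$. -}

module Defs where

open import Level using (0ℓ)
open import Data.Nat using (ℕ; zero; suc; _≤_; _<_)
open import Data.Bool using (Bool; true; false)
open import Data.Empty using (⊥)
open import Data.Product using (Σ; ∃; ∃-syntax; _×_; _,_)
open import Data.List using (List)
open import Data.List.Relation.Unary.All using (All)
open import Data.List.Membership.Propositional using (_∈_; _∉_)
open import Relation.Nullary using (¬_)
open import Relation.Unary using (Pred)
open import Relation.Binary.PropositionalEquality using (_≡_; _≢_)

-- Digraphs: a vertex type and an irreflexive edge relation.
-- (A relation gives "no parallel edges"; uv and vu may both be present.)

record Digraph : Set₁ where
  field
    Vertex  : Set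
    _⇒_     : Vertex → Vertex → Set
    noLoops : ∀ v → ¬ (v ⇒ v)

module _ (D : Digraph) where
  open Digraph D

  -- Finite vertex sets X ∈ 𝒳(D) are given as lists of vertices.
  FinSet : Set
  FinSet = List Vertex

  VSet : Set₁
  VSet = Pred Vertex 0ℓ

  data Reach (X : FinSet) : Vertex → Vertex → Set where
    here : ∀ {u} → u ∉ X → Reach X u u
    step : ∀ {u w v} → u ∉ X → u ⇒ w → Reach X w v → Reach X u v

  record IsStrongComponent (X : FinSet) (C : VSet) : Set where
    field
      avoids    : ∀ v → C v → v ∉ X
      nonempty  : ∃[ v ] C v
      connected : ∀ u v → C u → C v → Reach X u v
      maximal   : ∀ u v → C u → Reach X u v → Reach X v u → C v

  MeetsAll : List VSet → VSet → Set₁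
  MeetsAll 𝒰 C = All (λ U → ∃[ v ] (C v × U v)) 𝒰

  record Ray : Set where
    field
      vtx   : ℕ → Vertex
      inj   : ∀ m n → vtx m ≡ vtx n → m ≡ n
      edge  : ∀ n → vtx n ⇒ vtx (suc n)

  TailIn : Ray → ℕ → VSet → Set
  TailIn R n C = ∀ m → n ≤ m → C (Ray.vtx R m)

  HasTailIn : Ray → VSet → Set
  HasTailIn R C = ∃[ n ] TailIn R n C

  Solid : Ray → Set₁
  Solid R = ∀ (X : FinSet) → Σ VSet λ C → IsStrongComponent X C × HasTailIn R C

  -- An end is an equivalence class of solid rays; C(X, ω) is the strong
  -- component of D - X containing a tail of (any/every) ray of ω.
  -- D has an end in the closure of 𝒰 iff some solid ray R (a representative
  -- of the end ω) satisfies: for every X, C(X, ω) meets every U ∈ 𝒰.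
  EndInClosure : List VSet → Set₁
  EndInClosure 𝒰 =
    Σ Ray λ R → Solid R ×
      (∀ (X : FinSet) (C : VSet) → IsStrongComponent X C → HasTailIn R C →
         MeetsAll 𝒰 C)

  _⊆ᶠ_ : FinSet → FinSet → Set
  X ⊆ᶠ Y = ∀ x → x ∈ X → x ∈ Y

  record VertexDirection : Set₁ where
    field
      comp   : FinSet → VSet
      isComp : ∀ X → IsStrongComponent X (comp X)
      mono   : ∀ X Y → X ⊆ᶠ Y → ∀ v → comp Y v → comp X v

  VDInClosure : List VSet → Set₁
  VDInClosure 𝒰 =
    Σ VertexDirection λ f → ∀ X → MeetsAll 𝒰 (VertexDirection.comp f X)

  record DPath : Set where
    field
      len  : ℕ
      pv   : ℕ → Vertex
      inj  : ∀ i j → i ≤ len → j ≤ len → pv i ≡ pv j → i ≡ j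
      edge : ∀ i → i < len → pv i ⇒ pv (suc i)

  Inner : DPath → Vertex → Set
  Inner P v = ∃[ i ] (0 < i × i < DPath.len P × DPath.pv P i ≡ v)

  IsABPath : FinSet → FinSet → DPath → Set
  IsABPath A B P =
    pv 0 ∈ A × pv len ∈ B ×
    (∀ i → i ≤ len → pv i ∈ A → i ≡ 0) ×
    (∀ i → i ≤ len → pv i ∈ B → i ≡ len)
    where open DPath P

  data ReachIn (H : Vertex → Vertex → Set) : Vertex → Vertex → Set where
    here : ∀ {u} → ReachIn H u u
    step : ∀ {u w v} → H u w → ReachIn H w v → ReachIn H u v

  record Necklace : Set₁ where
    field
      bead       : ℕ → FinSet
      disjoint   : ∀ i j → i ≢ j → ∀ v → v ∈ bead i → v ∈ bead j → ⊥
      H          : ℕ → Vertex → Vertex → Set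
      H-sub      : ∀ i u v → H i u v → u ∈ bead i × v ∈ bead i × u ⇒ v
      H-nonempty : ∀ i → ∃[ v ] v ∈ bead i
      H-strong   : ∀ i u v → u ∈ bead i → v ∈ bead i → ReachIn (H i) u v
      -- path i true : bead i – bead (i+1) path; path i false : bead (i+1) – bead i path
      path       : ℕ → Bool → DPath
      fwd        : ∀ i → IsABPath (bead i) (bead (suc i)) (path i true)
      bwd        : ∀ i → IsABPath (bead (suc i)) (bead i) (path i false)
      innerDisj  : ∀ i b j c → (i , b) ≢ (j , c) → ∀ v →
                   Inner (path i b) v → Inner (path j c) v → ⊥
      innerBeads : ∀ i b v → Inner (path i b) v → ∀ j → v ∉ bead j

  Attached : List VSet → Necklace → Set₁
  Attached 𝒰 N = ∀ n → ∃[ i ] (n ≤ i × All (λ U → ∃[ v ] (v ∈ Necklace.bead N i × U v)) 𝒰)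

  HasAttachedNecklace : List VSet → Set₁
  HasAttachedNecklace 𝒰 = Σ Necklace λ N → Attached 𝒰 N

module Submission where

open import Defs
open import Level using (0ℓ)
open import Axiom.ExcludedMiddle using (ExcludedMiddle)
open import Data.Empty using (⊥; ⊥-elim)
open import Function.Base using (_∘_)
open import Function.Bundles using (_⇔_; mk⇔)
open import Data.Nat
open import Data.Nat.Properties
open import Data.Product using (_×_; Σ; ∃-syntax; _,_; proj₁; proj₂)
open import Data.Sum using (_⊎_; inj₁; inj₂)
open import Data.List using (List; []; _∷_; _++_)
open import Data.List.Membership.Propositional using (_∈_; _∉_)
open import Data.List.Membership.Propositional.Properties using (∈-++⁺ˡ; ∈-++⁺ʳ; ∈-++⁻)
open import Data.Bool using (Bool; true; false)
open import Data.List.Relation.Unary.All as All using (All; []; _∷_)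
open import Data.List.Relation.Unary.Any using (here; there)
open import Relation.Nullary using (¬_; yes; no)
open import Relation.Binary.PropositionalEquality
open import Relation.Binary.Definitions using (tri<; tri≈; tri>)

-- (i) ⇒ (ii): the components C(X, ω) of an end form a vertex-direction.
-- (ii) ⇒ (iii): given f, choose beads recursively: bead n is a finite strongly
-- connected set in f(X n) meeting every U ∈ 𝒰, where X (n+1) = X n ∪ bead n;
-- both links between bead n and bead n+1 are found inside the strongly
-- connected f(X n) ⊇ f(X (n+1)), with interiors outside bead n and f(X (n+1)),
-- which makes beads and links disjoint.
-- (iii) ⇒ (i): the ray running through the beads along the forward links is
-- solid: a finite X meets only finitely many beads and links, and the rest of
-- the necklace lies in a single strong component of D - X, which contains
-- attached beads and hence meets every U.

-- position n = (i , k) says that entry n of the concatenation of blocks of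
-- lengths L 0, L 1, … is entry k of block i.
module Concatenation (L : ℕ → ℕ) (L-pos : ∀ i → 0 < L i) where

  next : ℕ × ℕ → ℕ × ℕ
  next (i , k) with suc k <? L i
  ... | yes _ = i , suc k
  ... | no _  = suc i , 0

  position : ℕ → ℕ × ℕ
  position zero    = 0 , 0
  position (suc n) = next (position n)

  data NextCase (i k : ℕ) : ℕ × ℕ → Set where
    within : suc k < L i → NextCase i k (i , suc k)
    wrap   : suc k ≡ L i → NextCase i k (suc i , 0)

  next-case : ∀ i k → k < L i → NextCase i k (next (i , k))
  next-case i k k<L with suc k <? L i
  ... | yes sk<L = within sk<L
  ... | no  sk≮L = wrap (≤-antisym k<L (≮⇒≥ sk≮L))

  position-valid : ∀ n → proj₂ (position n) < L (proj₁ (position n))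
  position-valid zero = L-pos 0
  position-valid (suc n) with position n | position-valid n
  ... | i , k | k<L with next (i , k) | next-case i k k<L
  ...   | _ | within sk<L = sk<L
  ...   | _ | wrap _      = L-pos (suc i)

  position-suc : ∀ n → NextCase (proj₁ (position n)) (proj₂ (position n)) (position (suc n))
  position-suc n = next-case _ _ (position-valid n)

  offset : ℕ → ℕ
  offset zero    = 0
  offset (suc i) = offset i + L i

  offset-position : ∀ n → offset (proj₁ (position n)) + proj₂ (position n) ≡ n
  offset-position zero = refl
  offset-position (suc n) with position n | position-valid n | offset-position n
  ... | i , k | k<L | eq with next (i , k) | next-case i k k<L
  ...   | _ | within _ = trans (+-suc (offset i) k) (cong suc eq)
  ...   | _ | wrap sk≡L = begin
    offset i + L i + 0    ≡⟨ +-identityʳ _ ⟩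
    offset i + L i        ≡⟨ cong (offset i +_) (sym sk≡L) ⟩
    offset i + suc k      ≡⟨ +-suc (offset i) k ⟩
    suc (offset i + k)    ≡⟨ cong suc eq ⟩
    suc n                 ∎
    where open ≡-Reasoning

  position-injective : ∀ {m n} → position m ≡ position n → m ≡ n
  position-injective {m} {n} eq = begin
    m                                                ≡⟨ sym (offset-position m) ⟩
    offset (proj₁ (position m)) + proj₂ (position m) ≡⟨ cong (λ p → offset (proj₁ p) + proj₂ p) eq ⟩
    offset (proj₁ (position n)) + proj₂ (position n) ≡⟨ offset-position n ⟩
    n                                                ∎
    where open ≡-Reasoning

  offset-mono : ∀ {i j} → i ≤ j → offset i ≤ offset j
  offset-mono {j = zero} z≤n = ≤-refl
  offset-mono {i} {suc j} i≤1+j with m≤n⇒m<n∨m≡n i≤1+j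
  ... | inj₂ refl = ≤-refl
  ... | inj₁ i<1+j = ≤-trans (offset-mono (m<1+n⇒m≤n i<1+j)) (m≤m+n (offset j) (L j))

  offset≤⇒≤position : ∀ i n → offset i ≤ n → i ≤ proj₁ (position n)
  offset≤⇒≤position i n offset≤n with i ≤? proj₁ (position n)
  ... | yes i≤j = i≤j
  ... | no  i≰j = ⊥-elim (<-irrefl refl (begin-strict
    n                                                ≡⟨ sym (offset-position n) ⟩
    offset (proj₁ (position n)) + proj₂ (position n) <⟨ +-monoʳ-< _ (position-valid n) ⟩
    offset (suc (proj₁ (position n)))                ≤⟨ offset-mono (≰⇒> i≰j) ⟩
    offset i                                         ≤⟨ offset≤n ⟩
    n                                                ∎))
    where open ≤-Reasoning

Eventually : (ℕ → Set) → Set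
Eventually P = ∃[ N ] (∀ i → N ≤ i → P i)

eventually-∀∈ : {A : Set} {P : A → ℕ → Set} → (∀ x → Eventually (P x)) →
                (xs : List A) → Eventually (λ i → ∀ {x} → x ∈ xs → P x i)
eventually-∀∈ ev [] = 0 , λ _ _ ()
eventually-∀∈ ev (x ∷ xs) with ev x | eventually-∀∈ ev xs
... | N , PN | M , PM = N ⊔ M , λ where
  i N⊔M≤i (here refl)  → PN i (≤-trans (m≤m⊔n N M) N⊔M≤i)
  i N⊔M≤i (there x∈xs) → PM i (≤-trans (m≤n⊔m N M) N⊔M≤i) x∈xs

eventually-× : {P Q : ℕ → Set} → Eventually P → Eventually Q → Eventually (λ i → P i × Q i)
eventually-× (N , PN) (M , QM) =
  N ⊔ M , λ i N⊔M≤i → PN i (≤-trans (m≤m⊔n N M) N⊔M≤i) , QM i (≤-trans (m≤n⊔m N M) N⊔M≤i)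

module Development (em : ExcludedMiddle 0ℓ) (D : Digraph) where
  open Digraph D

  Restrict : (Vertex → Set) → (Vertex → Vertex → Set) → Vertex → Vertex → Set
  Restrict P R u v = P u × P v × R u v

  Spanned : FinSet D → Vertex → Vertex → Set
  Spanned B = Restrict (_∈ B) _⇒_

  module Walks (R : Vertex → Vertex → Set) where

    Walk : Vertex → Vertex → Set
    Walk = ReachIn D R

    length : ∀ {u v} → Walk u v → ℕ
    length here       = 0
    length (step _ w) = suc (length w)

    at : ∀ {u v} → Walk u v → ℕ → Vertex
    at {u} here       _       = u
    at {u} (step _ w) zero    = u
    at     (step _ w) (suc i) = at w i

    at-start : ∀ {u v} (w : Walk u v) → at w 0 ≡ u
    at-start here       = refl
    at-start (step _ _) = refl

    at-end : ∀ {u v} (w : Walk u v) {n} → length w ≤ n → at w n ≡ v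
    at-end here       _         = refl
    at-end (step _ w) (s≤s len≤n) = at-end w len≤n

    at-edge : ∀ {u v} (w : Walk u v) {i} → i < length w → R (at w i) (at w (suc i))
    at-edge (step e w) {zero}  _         = subst (R _) (sym (at-start w)) e
    at-edge (step e w) {suc i} (s≤s i<n) = at-edge w i<n

    at-invariant : ∀ {P : Vertex → Set} {u v} (w : Walk u v) → P u →
                   (∀ {a b} → R a b → P b) → ∀ i → P (at w i)
    at-invariant here       Pu _    _       = Pu
    at-invariant (step e w) Pu _    zero    = Pu
    at-invariant (step e w) Pu pres (suc i) = at-invariant w (pres e) pres i

    vertices : ∀ {u v} → Walk u v → List Vertex
    vertices {u} here       = u ∷ []
    vertices {u} (step _ w) = u ∷ vertices w

    at∈vertices : ∀ {u v} (w : Walk u v) i → at w i ∈ vertices w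
    at∈vertices here       _       = here refl
    at∈vertices (step _ w) zero    = here refl
    at∈vertices (step _ w) (suc i) = there (at∈vertices w i)

    start∈vertices : ∀ {u v} (w : Walk u v) → u ∈ vertices w
    start∈vertices w = subst (_∈ vertices w) (at-start w) (at∈vertices w 0)

    end∈vertices : ∀ {u v} (w : Walk u v) → v ∈ vertices w
    end∈vertices w = subst (_∈ vertices w) (at-end w ≤-refl) (at∈vertices w (length w))

    All-at : ∀ {P : Vertex → Set} {u v} (w : Walk u v) → All P (vertices w) → ∀ i → P (at w i)
    All-at w Pw i = All.lookup Pw (at∈vertices w i)

    _++ʷ_ : ∀ {u v w} → Walk u v → Walk v w → Walk u w
    here     ++ʷ q = q
    step e p ++ʷ q = step e (p ++ʷ q)

    ∈-++ʷ⁺ˡ : ∀ {u v w x} (p : Walk u v) (q : Walk v w) → x ∈ vertices p → x ∈ vertices (p ++ʷ q)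
    ∈-++ʷ⁺ˡ here       q (here refl) = start∈vertices q
    ∈-++ʷ⁺ˡ (step e p) q (here refl) = here refl
    ∈-++ʷ⁺ˡ (step e p) q (there x∈p) = there (∈-++ʷ⁺ˡ p q x∈p)

    ∈-++ʷ⁺ʳ : ∀ {u v w x} (p : Walk u v) (q : Walk v w) → x ∈ vertices q → x ∈ vertices (p ++ʷ q)
    ∈-++ʷ⁺ʳ here       q x∈q = x∈q
    ∈-++ʷ⁺ʳ (step e p) q x∈q = there (∈-++ʷ⁺ʳ p q x∈q)

    All-++ʷ : ∀ {P : Vertex → Set} {u v w} (p : Walk u v) (q : Walk v w) →
              All P (vertices p) → All P (vertices q) → All P (vertices (p ++ʷ q))
    All-++ʷ here       q _         Pq = Pq
    All-++ʷ (step e p) q (Pu ∷ Pp) Pq = Pu ∷ All-++ʷ p q Pp Pq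

    restrict : ∀ {P : Vertex → Set} {u v} (w : Walk u v) → All P (vertices w) →
               ReachIn D (Restrict P R) u v
    restrict here       _         = here
    restrict (step e w) (Pu ∷ Pw) = step (Pu , All.lookup Pw (start∈vertices w) , e) (restrict w Pw)

    split : ∀ {P : Vertex → Set} {u v x} (w : Walk u v) → All P (vertices w) → x ∈ vertices w →
            ReachIn D (Restrict P R) u x × ReachIn D (Restrict P R) x v
    split here       _          (here refl) = here , here
    split (step e w) Pw         (here refl) = here , restrict (step e w) Pw
    split (step e w) (Pu ∷ Pw) (there x∈w) with split w Pw x∈w
    ... | w₀→x , x→v = step (Pu , All.lookup Pw (start∈vertices w) , e) w₀→x , x→v

    Simple : ∀ {u v} → Walk u v → Set
    Simple w = ∀ i j → i ≤ length w → j ≤ length w → at w i ≡ at w j → i ≡ j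

    record _⊆ᵛ_ {u v u′ v′} (p : Walk u v) (w : Walk u′ v′) : Set where
      constructor mk⊆ᵛ
      field occurrence : ∀ i → ∃[ j ] (at p i ≡ at w j)
    open _⊆ᵛ_

    ⊆ᵛ-trans : ∀ {a b c d e f} {p : Walk a b} {q : Walk c d} {w : Walk e f} → p ⊆ᵛ q → q ⊆ᵛ w → p ⊆ᵛ w
    ⊆ᵛ-trans p⊆q q⊆w = mk⊆ᵛ λ i →
      let (j , eq₁) = occurrence p⊆q i ; (k , eq₂) = occurrence q⊆w j in k , trans eq₁ eq₂

    ⊆ᵛ-at : ∀ {P : Vertex → Set} {a b c d} {p : Walk a b} {w : Walk c d} → p ⊆ᵛ w →
            (∀ j → P (at w j)) → ∀ i → P (at p i)
    ⊆ᵛ-at {P} p⊆w Pw i = let (j , eq) = occurrence p⊆w i in subst P (sym eq) (Pw j)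

    ⊆ᵛ-there : ∀ {a b u w v} {p : Walk a b} {e : R u w} {q : Walk w v} → p ⊆ᵛ q → p ⊆ᵛ step e q
    ⊆ᵛ-there p⊆q = mk⊆ᵛ λ i → let (j , eq) = occurrence p⊆q i in suc j , eq

    ⊆ᵛ-step : ∀ {u w v w′ v′} {e : R u w} {e′ : R u w′} {p : Walk w v} {q : Walk w′ v′} →
              p ⊆ᵛ q → step e p ⊆ᵛ step e′ q
    ⊆ᵛ-step p⊆q = mk⊆ᵛ λ where
      zero    → 0 , refl
      (suc i) → occurrence (⊆ᵛ-there p⊆q) i

    drop : ∀ {u v} i (w : Walk u v) → Walk (at w i) v
    drop zero    here       = here
    drop zero    (step e w) = step e w
    drop (suc i) here       = here
    drop (suc i) (step e w) = drop i w

    at-drop : ∀ {u v} i (w : Walk u v) k → at (drop i w) k ≡ at w (i + k)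
    at-drop zero    here       k = refl
    at-drop zero    (step e w) k = refl
    at-drop (suc i) here       k = refl
    at-drop (suc i) (step e w) k = at-drop i w k

    drop-simple : ∀ {u v} i (w : Walk u v) → Simple w → Simple (drop i w)
    drop-simple zero    here       s = s
    drop-simple zero    (step e w) s = s
    drop-simple (suc i) here       s = s
    drop-simple (suc i) (step e w) s = drop-simple i w λ a b a≤ b≤ eq →
      suc-injective (s (suc a) (suc b) (s≤s a≤) (s≤s b≤) eq)

    -- Vertex equality is not decidable, so whether u reappears on the
    -- simplified tail (and the cycle through u must be cut) is decided by
    -- excluded middle.
    simplify : ∀ {u v} (w : Walk u v) → Σ (Walk u v) λ p → Simple p × p ⊆ᵛ w
    simplify here = here , (λ { _ _ z≤n z≤n _ → refl }) , mk⊆ᵛ λ i → i , refl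
    simplify (step {u} e w) with simplify w
    ... | p , p-simple , p⊆w with em {∃[ j ] at p j ≡ u}
    ... | yes (j , refl) = drop j p , drop-simple j p p-simple , mk⊆ᵛ λ k →
          let (l , eq) = occurrence p⊆w (j + k) in suc l , trans (at-drop j p k) eq
    ... | no u∉p = step e p , simple , ⊆ᵛ-step p⊆w
      where
      simple : Simple (step e p)
      simple zero    zero    _         _         _  = refl
      simple zero    (suc j) _         _         eq = ⊥-elim (u∉p (j , sym eq))
      simple (suc i) zero    _         _         eq = ⊥-elim (u∉p (i , eq))
      simple (suc i) (suc j) (s≤s i≤) (s≤s j≤) eq = cong suc (p-simple i j i≤ j≤ eq)

    Clean : (A B : Vertex → Set) → ∀ {u v} → Walk u v → Set
    Clean A B w = ∀ i → 0 < i → i < length w → ¬ A (at w i) × ¬ B (at w i)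

    clean-step : ∀ {A B : Vertex → Set} {u w v} (e : R u w) (p : Walk w v) →
                 ¬ A w → ¬ B w → Clean A B p → Clean A B (step e p)
    clean-step {A} {B} e p ¬Aw ¬Bw _ (suc zero) _ _ =
      subst (λ x → ¬ A x × ¬ B x) (sym (at-start p)) (¬Aw , ¬Bw)
    clean-step e p _ _ cl (suc (suc i)) _ (s≤s i<) = cl (suc i) (s≤s z≤n) i<

    record ABWalk (A B : Vertex → Set) {u v} (w : Walk u v) : Set where
      constructor mkABWalk
      field
        first last : Vertex
        walk       : Walk first last
        first∈A    : A first
        last∈B     : B last
        walk⊆ᵛw    : walk ⊆ᵛ w
        clean      : Clean A B walk

    abWalk-there : ∀ {A B u w v} {e : R u w} {q : Walk w v} → ABWalk A B q → ABWalk A B (step e q)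
    abWalk-there (mkABWalk a b p Aa Bb p⊆q cl) = mkABWalk a b p Aa Bb (⊆ᵛ-there p⊆q) cl

    -- The left case is an A–B walk except that u need not lie in A; it is
    -- completed by the last vertex of A met before it on w.
    cleanPrefixOrABWalk : ∀ {A B : Vertex → Set} {u v} (w : Walk u v) → B v → ¬ B u →
      (Σ Vertex λ b → Σ (Walk u b) λ p → B b × p ⊆ᵛ w × Clean A B p) ⊎ ABWalk A B w
    cleanPrefixOrABWalk here Bv ¬Bv = ⊥-elim (¬Bv Bv)
    cleanPrefixOrABWalk {A} {B} (step {w = w₁} e w) Bv ¬Bu with em {B w₁}
    ... | yes Bw₁ = inj₁ (w₁ , step e here , Bw₁ , ⊆ᵛ-step (mk⊆ᵛ λ i → 0 , sym (at-start w)) ,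
                          λ { (suc i) _ (s≤s ()) })
    ... | no ¬Bw₁ with cleanPrefixOrABWalk {A} w Bv ¬Bw₁
    ...   | inj₂ c = inj₂ (abWalk-there c)
    ...   | inj₁ (b , p , Bb , p⊆w , cl) with em {A w₁}
    ...     | yes Aw₁ = inj₂ (mkABWalk w₁ b p Aw₁ Bb (⊆ᵛ-there p⊆w) cl)
    ...     | no ¬Aw₁ = inj₁ (b , step e p , Bb , ⊆ᵛ-step p⊆w , clean-step {A} {B} e p ¬Aw₁ ¬Bw₁ cl)

    abWalk : ∀ {A B : Vertex → Set} → (∀ {x} → A x → ¬ B x) →
             ∀ {u v} (w : Walk u v) → A u → B v → ABWalk A B w
    abWalk {A} disjoint {u} w Au Bv with cleanPrefixOrABWalk {A} w Bv (disjoint Au)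
    ... | inj₁ (b , p , Bb , p⊆w , cl) = mkABWalk u b p Au Bb p⊆w cl
    ... | inj₂ c = c

    -- An interior vertex of the simplified walk lies on w and, by simplicity,
    -- is neither of the shared endpoints, so it is interior on w.
    simplify-clean : ∀ {A B : Vertex → Set} {u v} (w : Walk u v) → Clean A B w →
                     Clean A B (proj₁ (simplify w))
    simplify-clean {A} {B} w cl i 0<i i<len with simplify w
    ... | p , p-simple , p⊆w with occurrence p⊆w i
    ... | j , eq with j ≟ 0 | length w ≤? j
    ...   | yes refl | _ = ⊥-elim (<⇒≢ 0<i (sym (p-simple i 0 (<⇒≤ i<len) z≤n
                             (trans eq (trans (at-start w) (sym (at-start p)))))))
    ...   | no _ | yes len≤j = ⊥-elim (<⇒≢ i<len (p-simple i (length p) (<⇒≤ i<len) ≤-refl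
                             (trans eq (trans (at-end w len≤j) (sym (at-end p ≤-refl))))))
    ...   | no j≢0 | no len≰j = subst (λ x → ¬ A x × ¬ B x) (sym eq)
                             (cl j (n≢0⇒n>0 j≢0) (≰⇒> len≰j))

  open Walks _⇒_
  open DPath using (len; pv)
  open IsStrongComponent

  reach-trans : ∀ {X u w v} → Reach D X u w → Reach D X w v → Reach D X u v
  reach-trans (here _)       r = r
  reach-trans (step u∉ e r₁) r = step u∉ e (reach-trans r₁ r)

  reach-target∉ : ∀ {X u v} → Reach D X u v → v ∉ X
  reach-target∉ (here v∉)    = v∉
  reach-target∉ (step _ _ r) = reach-target∉ r

  reach-antitone : ∀ {X Y u v} → _⊆ᶠ_ D X Y → Reach D Y u v → Reach D X u v
  reach-antitone X⊆Y (here u∉)    = here (u∉ ∘ X⊆Y _)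
  reach-antitone X⊆Y (step u∉ e r) = step (u∉ ∘ X⊆Y _) e (reach-antitone X⊆Y r)

  walk→reach : ∀ {X u v} (w : Walk u v) → All (_∉ X) (vertices w) → Reach D X u v
  walk→reach here       (u∉ ∷ []) = here u∉
  walk→reach (step e w) (u∉ ∷ w∉) = step u∉ e (walk→reach w w∉)

  reach→walk : ∀ {X u v} → Reach D X u v → Σ (Walk u v) λ w → All (_∉ X) (vertices w)
  reach→walk (here u∉) = here , u∉ ∷ []
  reach→walk (step u∉ e r) with reach→walk r
  ... | w , w∉ = step e w , u∉ ∷ w∉

  componentOf : FinSet D → Vertex → VSet D
  componentOf X a v = Reach D X a v × Reach D X v a

  componentOf-strong : ∀ {X a} → a ∉ X → IsStrongComponent D X (componentOf X a)
  componentOf-strong a∉X = record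
    { avoids    = λ v a~v → reach-target∉ (proj₁ a~v)
    ; nonempty  = _ , here a∉X , here a∉X
    ; connected = λ u v a~u a~v → reach-trans (proj₂ a~u) (proj₁ a~v)
    ; maximal   = λ u v a~u u→v v→u → reach-trans (proj₁ a~u) u→v , reach-trans v→u (proj₂ a~u)
    }

  strongComponent-⊇ : ∀ {X Y C C′ r} → _⊆ᶠ_ D X Y →
                      IsStrongComponent D X C → IsStrongComponent D Y C′ →
                      C r → C′ r → ∀ v → C′ v → C v
  strongComponent-⊇ X⊆Y C-strong C′-strong Cr C′r v C′v = maximal C-strong _ v Cr
    (reach-antitone X⊆Y (connected C′-strong _ v C′r C′v))
    (reach-antitone X⊆Y (connected C′-strong v _ C′v C′r))

  walk-in-component : ∀ {X C u v} → IsStrongComponent D X C → (w : Walk u v) →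
                      All (_∉ X) (vertices w) → C u → Reach D X v u → All C (vertices w)
  walk-in-component C-strong here       _         Cu _   = Cu ∷ []
  walk-in-component C-strong (step e w) (u∉ ∷ w∉) Cu v→u =
    Cu ∷ walk-in-component C-strong w w∉ Cw (reach-trans v→u u→w)
    where
    u→w = step u∉ e (here (All.lookup w∉ (start∈vertices w)))
    Cw  = maximal C-strong _ _ Cu u→w (reach-trans (walk→reach w w∉) v→u)

  componentWalk : ∀ {X C u v} → IsStrongComponent D X C → C u → C v →
                  Σ (Walk u v) λ w → All C (vertices w)
  componentWalk C-strong Cu Cv with reach→walk (connected C-strong _ _ Cu Cv)
  ... | w , w∉ = w , walk-in-component C-strong w w∉ Cu (connected C-strong _ _ Cv Cu)

  walkPath : ∀ {u v} (p : Walk u v) → Simple p → DPath D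
  walkPath p p-simple = record { len = length p ; pv = at p ; inj = p-simple ; edge = λ i → at-edge p }

  dpath-reach : ∀ {X} (P : DPath D) {a} b → a ≤ b → b ≤ len P →
                (∀ k → a ≤ k → k ≤ b → pv P k ∉ X) → Reach D X (pv P a) (pv P b)
  dpath-reach P zero    z≤n _ avoid = here (avoid 0 z≤n z≤n)
  dpath-reach P {a} (suc b) a≤1+b b<len avoid with a ≟ suc b
  ... | yes refl = here (avoid a ≤-refl ≤-refl)
  ... | no a≢1+b = reach-trans
    (dpath-reach P b a≤b (<⇒≤ b<len) λ k a≤k k≤b → avoid k a≤k (m≤n⇒m≤1+n k≤b))
    (step (avoid b a≤b (n≤1+n b)) (DPath.edge P b b<len) (here (avoid (suc b) a≤1+b ≤-refl)))
    where a≤b = m<1+n⇒m≤n (≤∧≢⇒< a≤1+b a≢1+b)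

  record ABPathIn (C A B : Vertex → Set) : Set where
    field
      path     : DPath D
      first∈A  : A (pv path 0)
      last∈B   : B (pv path (len path))
      inside   : ∀ k → C (pv path k)
      interior : ∀ k → 0 < k → k < len path → ¬ A (pv path k) × ¬ B (pv path k)

  open ABPathIn

  componentABPath : ∀ {X C} {A B : Vertex → Set} {a b} → IsStrongComponent D X C →
                    (∀ {x} → A x → ¬ B x) → C a → C b → A a → B b → ABPathIn C A B
  componentABPath {C = C} {A} {B} C-strong disjoint Ca Cb Aa Bb with componentWalk C-strong Ca Cb
  ... | w , w⊆C with abWalk disjoint w Aa Bb
  ... | mkABWalk _ _ p Ap Bp p⊆w cl with simplify p | simplify-clean {A} {B} p cl
  ... | q , q-simple , q⊆p | q-clean = record
    { path     = walkPath q q-simple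
    ; first∈A  = subst A (sym (at-start q)) Ap
    ; last∈B   = subst B (sym (at-end q ≤-refl)) Bp
    ; inside   = ⊆ᵛ-at {C} (⊆ᵛ-trans q⊆p p⊆w) (All-at w w⊆C)
    ; interior = q-clean
    }

  isABPath : ∀ {A B : FinSet D} (P : DPath D) → pv P 0 ∈ A → pv P (len P) ∈ B →
             (∀ k → 0 < k → k < len P → pv P k ∉ A × pv P k ∉ B) →
             (∀ {x} → x ∈ A → x ∉ B) → IsABPath D A B P
  isABPath {A} {B} P first∈A last∈B interior disjoint = first∈A , last∈B , onlyFirst , onlyLast
    where
    onlyFirst : ∀ i → i ≤ len P → pv P i ∈ A → i ≡ 0
    onlyFirst zero    _   _   = refl
    onlyFirst (suc i) i≤ x∈A with suc i ≟ len P
    ... | yes eq   = ⊥-elim (disjoint x∈A (subst (λ k → pv P k ∈ B) (sym eq) last∈B))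
    ... | no i≢len = ⊥-elim (proj₁ (interior (suc i) (s≤s z≤n) (≤∧≢⇒< i≤ i≢len)) x∈A)
    onlyLast : ∀ i → i ≤ len P → pv P i ∈ B → i ≡ len P
    onlyLast zero    _   x∈B = ⊥-elim (disjoint first∈A x∈B)
    onlyLast (suc i) i≤ x∈B with suc i ≟ len P
    ... | yes eq   = eq
    ... | no i≢len = ⊥-elim (proj₂ (interior (suc i) (s≤s z≤n) (≤∧≢⇒< i≤ i≢len)) x∈B)

  module _ {C A B : Vertex → Set} (P : ABPathIn C A B) (disjoint : ∀ {x} → A x → ¬ B x) where

    abPath-¬A : ∀ j → 0 < j → j ≤ len (path P) → ¬ A (pv (path P) j)
    abPath-¬A j 0<j j≤len with j ≟ len (path P)
    ... | yes eq   = λ Aj → disjoint Aj (subst (λ k → B (pv (path P) k)) (sym eq) (last∈B P))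
    ... | no j≢len = proj₁ (interior P j 0<j (≤∧≢⇒< j≤len j≢len))

    abPath-¬B : ∀ j → j < len (path P) → ¬ B (pv (path P) j)
    abPath-¬B zero    _     = disjoint (first∈A P)
    abPath-¬B (suc j) j<len = proj₂ (interior P (suc j) (s≤s z≤n) j<len)

  end⇒direction : ∀ {𝒰} → EndInClosure D 𝒰 → VDInClosure D 𝒰
  end⇒direction (R , solid , closure) = direction , λ X → closure X _ (C-strong X) (C-tail X)
    where
    C : FinSet D → VSet D
    C X = proj₁ (solid X)
    C-strong : ∀ X → IsStrongComponent D X (C X)
    C-strong X = proj₁ (proj₂ (solid X))
    C-tail : ∀ X → HasTailIn D R (C X)
    C-tail X = proj₂ (proj₂ (solid X))
    C-antitone : ∀ X Y → _⊆ᶠ_ D X Y → ∀ v → C Y v → C X v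
    C-antitone X Y X⊆Y with C-tail X | C-tail Y
    ... | m , tailX | n , tailY = strongComponent-⊇ X⊆Y (C-strong X) (C-strong Y)
      (tailX (m ⊔ n) (m≤m⊔n m n)) (tailY (m ⊔ n) (m≤n⊔m m n))
    direction : VertexDirection D
    direction = record { comp = C ; isComp = C-strong ; mono = C-antitone }

  record Bead (C : VSet D) : Set where
    field
      carrier  : FinSet D
      inside   : ∀ {x} → x ∈ carrier → C x
      nonempty : ∃[ v ] v ∈ carrier
      strong   : ∀ u v → u ∈ carrier → v ∈ carrier → ReachIn D (Spanned carrier) u v

  module _ {X C} (C-strong : IsStrongComponent D X C) where
    private
      s₀ : Vertex
      s₀ = proj₁ (nonempty C-strong)
      C-s₀ : C s₀
      C-s₀ = proj₂ (nonempty C-strong)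

    closedWalkThrough : (S : List Vertex) → All C S →
      Σ (Walk s₀ s₀) λ t → All C (vertices t) × (∀ {x} → x ∈ S → x ∈ vertices t)
    closedWalkThrough []      []        = here , C-s₀ ∷ [] , λ ()
    closedWalkThrough (s ∷ S) (C-s ∷ CS)
      with componentWalk C-strong C-s₀ C-s | componentWalk C-strong C-s C-s₀ | closedWalkThrough S CS
    ... | p , Cp | q , Cq | t , Ct , S⊆t =
      p ++ʷ (q ++ʷ t) , All-++ʷ p _ Cp (All-++ʷ q t Cq Ct) , λ where
        (here refl) → ∈-++ʷ⁺ˡ p _ (end∈vertices p)
        (there x∈S) → ∈-++ʷ⁺ʳ p _ (∈-++ʷ⁺ʳ q t (S⊆t x∈S))

    -- The bead is the vertex set of a closed walk through s₀ and all seeds: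
    -- every vertex of it reaches s₀ and is reached from s₀ along the walk.
    beadThrough : (S : List Vertex) → All C S →
                  Σ (Bead C) λ bead → ∀ {x} → x ∈ S → x ∈ Bead.carrier bead
    beadThrough S CS with closedWalkThrough S CS
    ... | t , Ct , S⊆t = record
      { carrier  = vertices t
      ; inside   = All.lookup Ct
      ; nonempty = s₀ , start∈vertices t
      ; strong   = λ u v u∈t v∈t →
          Walks._++ʷ_ (Spanned (vertices t)) (proj₂ (split t t⊆t u∈t)) (proj₁ (split t t⊆t v∈t))
      } , S⊆t
      where
      t⊆t : All (_∈ vertices t) (vertices t)
      t⊆t = All.tabulate (λ x∈t → x∈t)

  meetsAll-mono : ∀ {𝒰 : List (VSet D)} {P Q : Vertex → Set} →
                  (∀ {v} → P v → Q v) → MeetsAll D 𝒰 P → MeetsAll D 𝒰 Q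
  meetsAll-mono P⊆Q = All.map λ (v , Pv , Uv) → v , P⊆Q Pv , Uv

  meetingList : ∀ {𝒰 : List (VSet D)} {C : VSet D} → MeetsAll D 𝒰 C →
                Σ (List Vertex) λ L → All C L × MeetsAll D 𝒰 (_∈ L)
  meetingList []                     = [] , [] , []
  meetingList ((v , Cv , Uv) ∷ meets) with meetingList meets
  ... | L , CL , meetsL = v ∷ L , Cv ∷ CL , (v , here refl , Uv) ∷ meetsAll-mono there meetsL

  ∉-++ : ∀ {x} {Y Z : FinSet D} → x ∉ Y → x ∉ Z → x ∉ Y ++ Z
  ∉-++ {Y = Y} x∉Y x∉Z x∈Y++Z with ∈-++⁻ Y x∈Y++Z
  ... | inj₁ x∈Y = x∉Y x∈Y
  ... | inj₂ x∈Z = x∉Z x∈Z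

  module DirectionToNecklace (𝒰 : List (VSet D)) (f : VertexDirection D)
                             (f-meets : ∀ X → MeetsAll D 𝒰 (VertexDirection.comp f X)) where
    open VertexDirection f

    record Stage : Set₁ where
      field
        deleted : FinSet D
        bead    : Bead (comp deleted)
        meets   : MeetsAll D 𝒰 (_∈ Bead.carrier bead)

    initial : Stage
    initial = record { deleted = [] ; bead = proj₁ bead₀ ; meets = meetsAll-mono (proj₂ bead₀) (proj₂ (proj₂ seeds)) }
      where
      seeds = meetingList (f-meets [])
      bead₀ = beadThrough (isComp []) (proj₁ seeds) (proj₁ (proj₂ seeds))

    module Next (s : Stage) where
      X₀ : FinSet D
      X₀ = Stage.deleted s
      B₀ : FinSet D
      B₀ = Bead.carrier (Stage.bead s)
      X₁ : FinSet D
      X₁ = X₀ ++ B₀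
      C₀ C₁ : VSet D
      C₀ = comp X₀
      C₁ = comp X₁

      C₁⊆C₀ : ∀ {v} → C₁ v → C₀ v
      C₁⊆C₀ = mono X₀ X₁ (λ _ → ∈-++⁺ˡ) _

      B₀∩C₁ : ∀ {x} → x ∈ B₀ → ¬ C₁ x
      B₀∩C₁ x∈B₀ C₁x = avoids (isComp X₁) _ C₁x (∈-++⁺ʳ X₀ x∈B₀)

      C₁∩B₀ : ∀ {x} → C₁ x → x ∉ B₀
      C₁∩B₀ C₁x x∈B₀ = B₀∩C₁ x∈B₀ C₁x

      private
        a∈B₀ = proj₂ (Bead.nonempty (Stage.bead s))
        C₀a  = Bead.inside (Stage.bead s) a∈B₀
        C₁c  = proj₂ (nonempty (isComp X₁))

      forward : ABPathIn C₀ (_∈ B₀) C₁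
      forward = componentABPath (isComp X₀) B₀∩C₁ C₀a (C₁⊆C₀ C₁c) a∈B₀ C₁c

      backward : ABPathIn C₀ C₁ (_∈ B₀)
      backward = componentABPath (isComp X₀) C₁∩B₀ (C₁⊆C₀ C₁c) C₀a C₁c a∈B₀

      seeds : Σ (List Vertex) λ L → All C₁ L × MeetsAll D 𝒰 (_∈ L)
      seeds = meetingList (f-meets X₁)

      bead₁ : Σ (Bead C₁) λ bead → ∀ {x} →
              x ∈ pv (path forward) (len (path forward)) ∷ pv (path backward) 0 ∷ proj₁ seeds →
              x ∈ Bead.carrier bead
      bead₁ = beadThrough (isComp X₁) _ (last∈B forward ∷ first∈A backward ∷ proj₁ (proj₂ seeds))

      next : Stage
      next = record
        { deleted = X₁
        ; bead    = proj₁ bead₁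
        ; meets   = meetsAll-mono (proj₂ bead₁ ∘ there ∘ there) (proj₂ (proj₂ seeds))
        }

      link : Bool → DPath D
      link true  = path forward
      link false = path backward

      link-inside : ∀ b k → C₀ (pv (link b) k)
      link-inside true  = inside forward
      link-inside false = inside backward

      link-interior : ∀ b k → 0 < k → k < len (link b) → pv (link b) k ∉ B₀ × ¬ C₁ (pv (link b) k)
      link-interior true  = interior forward
      link-interior false k 0<k k<len = let (C₁∌ , B₀∌) = interior backward k 0<k k<len in B₀∌ , C₁∌

      -- A common interior vertex would lie in C₁: in D - X₁ it is reached from
      -- the start of the backward link and reaches the end of the forward link.
      links-disjoint : ∀ v → Inner D (link true) v → Inner D (link false) v → ⊥
      links-disjoint v (k , 0<k , k<lenF , refl) (l , 0<l , l<lenB , z≡) =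
        proj₂ (interior forward k 0<k k<lenF) C₁z
        where
        F = path forward
        Bk = path backward
        z→end : Reach D X₁ (pv F k) (pv F (len F))
        z→end = dpath-reach F (len F) (<⇒≤ k<lenF) ≤-refl λ j k≤j j≤len →
          ∉-++ (avoids (isComp X₀) _ (inside forward j))
               (abPath-¬A forward B₀∩C₁ j (<-≤-trans 0<k k≤j) j≤len)
        start→z : Reach D X₁ (pv Bk 0) (pv F k)
        start→z = subst (Reach D X₁ (pv Bk 0)) z≡ (dpath-reach Bk l z≤n (<⇒≤ l<lenB) λ j _ j≤l →
          ∉-++ (avoids (isComp X₀) _ (inside backward j))
               (abPath-¬B backward C₁∩B₀ j (≤-<-trans j≤l l<lenB)))
        C₁z : C₁ (pv F k)
        C₁z = maximal (isComp X₁) _ _ (last∈B forward)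
          (reach-trans (connected (isComp X₁) _ _ (last∈B forward) (first∈A backward)) start→z) z→end

    stage : ℕ → Stage
    stage zero    = initial
    stage (suc n) = Next.next (stage n)

    X : ℕ → FinSet D
    X n = Stage.deleted (stage n)

    B : ℕ → FinSet D
    B n = Bead.carrier (Stage.bead (stage n))

    C : ℕ → VSet D
    C n = comp (X n)

    link : ℕ → Bool → DPath D
    link n = Next.link (stage n)

    X-mono : ∀ {m n} → m ≤ n → _⊆ᶠ_ D (X m) (X n)
    X-mono {n = zero} z≤n _ x∈ = x∈
    X-mono {m} {suc n} m≤1+n x x∈ with m≤n⇒m<n∨m≡n m≤1+n
    ... | inj₂ refl  = x∈
    ... | inj₁ m<1+n = ∈-++⁺ˡ (X-mono (m<1+n⇒m≤n m<1+n) x x∈)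

    C-antitone : ∀ {m n} → m ≤ n → ∀ {v} → C n v → C m v
    C-antitone m≤n = mono _ _ (X-mono m≤n) _

    B⊆C : ∀ n {x} → x ∈ B n → C n x
    B⊆C n = Bead.inside (Stage.bead (stage n))

    B⊆X : ∀ {m n} → m < n → ∀ {x} → x ∈ B m → x ∈ X n
    B⊆X {m} m<n x∈ = X-mono m<n _ (∈-++⁺ʳ (X m) x∈)

    beads-disjoint-< : ∀ {i j} → i < j → ∀ {v} → v ∈ B i → v ∉ B j
    beads-disjoint-< {j = j} i<j v∈Bi v∈Bj = avoids (isComp (X j)) _ (B⊆C j v∈Bj) (B⊆X i<j v∈Bi)

    beads-disjoint : ∀ i j → i ≢ j → ∀ v → v ∈ B i → v ∈ B j → ⊥
    beads-disjoint i j i≢j v v∈Bi v∈Bj with <-cmp i j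
    ... | tri< i<j _ _ = beads-disjoint-< i<j v∈Bi v∈Bj
    ... | tri≈ _ i≡j _ = i≢j i≡j
    ... | tri> _ _ j<i = beads-disjoint-< j<i v∈Bj v∈Bi

    inner-facts : ∀ n b {v} → Inner D (link n b) v → C n v × v ∉ B n × ¬ C (suc n) v
    inner-facts n b (k , 0<k , k<len , refl) =
      Next.link-inside (stage n) b k , Next.link-interior (stage n) b k 0<k k<len

    inner∉beads : ∀ i b v → Inner D (link i b) v → ∀ j → v ∉ B j
    inner∉beads i b v inner j v∈Bj with inner-facts i b inner | <-cmp j i
    ... | C-i , _ , _ | tri< j<i _ _  = avoids (isComp (X i)) v C-i (B⊆X j<i v∈Bj)
    ... | _ , ∉Bi , _ | tri≈ _ refl _ = ∉Bi v∈Bj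
    ... | _ , _ , ∉C  | tri> _ _ i<j  = ∉C (C-antitone i<j (B⊆C j v∈Bj))

    links-inner-disjoint : ∀ i b j c → (i , b) ≢ (j , c) → ∀ v →
                           Inner D (link i b) v → Inner D (link j c) v → ⊥
    links-inner-disjoint i b j c ne v in₁ in₂ with <-cmp i j
    ... | tri< i<j _ _ = proj₂ (proj₂ (inner-facts i b in₁)) (C-antitone i<j (proj₁ (inner-facts j c in₂)))
    ... | tri> _ _ j<i = proj₂ (proj₂ (inner-facts j c in₂)) (C-antitone j<i (proj₁ (inner-facts i b in₁)))
    ... | tri≈ _ refl _ with b | c
    ...   | true  | true  = ne refl
    ...   | false | false = ne refl
    ...   | true  | false = Next.links-disjoint (stage i) v in₁ in₂
    ...   | false | true  = Next.links-disjoint (stage i) v in₂ in₁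

    forward-isAB : ∀ i → IsABPath D (B i) (B (suc i)) (link i true)
    forward-isAB i = isABPath (link i true) (first∈A forward) (proj₂ bead₁ (here refl))
      (λ k 0<k k<len → let (∉B₀ , ¬C₁) = link-interior true k 0<k k<len in ∉B₀ , ¬C₁ ∘ B⊆C (suc i))
      (beads-disjoint-< (n<1+n i))
      where open Next (stage i) using (forward; bead₁; link-interior)

    backward-isAB : ∀ i → IsABPath D (B (suc i)) (B i) (link i false)
    backward-isAB i = isABPath (link i false) (proj₂ bead₁ (there (here refl))) (last∈B backward)
      (λ k 0<k k<len → let (∉B₀ , ¬C₁) = link-interior false k 0<k k<len in ¬C₁ ∘ B⊆C (suc i) , ∉B₀)
      (λ x∈B₁ x∈B₀ → beads-disjoint-< (n<1+n i) x∈B₀ x∈B₁)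
      where open Next (stage i) using (backward; bead₁; link-interior)

    necklace : Necklace D
    necklace = record
      { bead       = B
      ; disjoint   = beads-disjoint
      ; H          = λ i → Spanned (B i)
      ; H-sub      = λ i u v uv → uv
      ; H-nonempty = λ i → Bead.nonempty (Stage.bead (stage i))
      ; H-strong   = λ i → Bead.strong (Stage.bead (stage i))
      ; path       = link
      ; fwd        = forward-isAB
      ; bwd        = backward-isAB
      ; innerDisj  = links-inner-disjoint
      ; innerBeads = inner∉beads
      }

    attached : Attached D 𝒰 necklace
    attached n = n , ≤-refl , Stage.meets (stage n)

  direction⇒necklace : ∀ {𝒰} → VDInClosure D 𝒰 → HasAttachedNecklace D 𝒰
  direction⇒necklace {𝒰} (f , f-meets) = necklace , attached
    where open DirectionToNecklace 𝒰 f f-meets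

  module NecklaceToEnd (𝒰 : List (VSet D)) (N : Necklace D) (N-attached : Attached D 𝒰 N) where
    open Necklace N renaming (path to link)
    private module HW (i : ℕ) = Walks (H i)

    F : ℕ → DPath D
    F i = link i true

    ℓ : ℕ → ℕ
    ℓ i = len (F i)

    exit : ℕ → Vertex
    exit i = pv (F i) 0

    entry : ℕ → Vertex
    entry zero    = exit 0
    entry (suc i) = pv (F i) (ℓ i)

    exit∈bead : ∀ i → exit i ∈ bead i
    exit∈bead i = proj₁ (fwd i)

    entry∈bead : ∀ i → entry i ∈ bead i
    entry∈bead zero    = exit∈bead 0
    entry∈bead (suc i) = proj₁ (proj₂ (fwd i))

    0<ℓ : ∀ i → 0 < ℓ i
    0<ℓ i = n≢0⇒n>0 λ ℓ≡0 → disjoint i (suc i) (λ i≡1+i → 1+n≢n (sym i≡1+i)) (exit i) (exit∈bead i)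
      (subst (λ k → pv (F i) k ∈ bead (suc i)) ℓ≡0 (entry∈bead (suc i)))

    private
      entry→exit : ∀ i → ReachIn D (H i) (entry i) (exit i)
      entry→exit i = H-strong i _ _ (entry∈bead i) (exit∈bead i)

    crossing : ∀ i → ReachIn D (H i) (entry i) (exit i)
    crossing i = proj₁ (HW.simplify i (entry→exit i))

    crossing-simple : ∀ i → HW.Simple i (crossing i)
    crossing-simple i = proj₁ (proj₂ (HW.simplify i (entry→exit i)))

    β : ℕ → ℕ
    β i = HW.length i (crossing i)

    crossing∈bead : ∀ i k → HW.at i (crossing i) k ∈ bead i
    crossing∈bead i = HW.⊆ᵛ-at i {P = _∈ bead i} (proj₂ (proj₂ (HW.simplify i (entry→exit i))))
      (HW.at-invariant i (entry→exit i) (entry∈bead i) λ h → proj₁ (proj₂ (H-sub i _ _ h)))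

    L : ℕ → ℕ
    L i = β i + ℓ i

    -- Segment i of the ray: the crossing of bead i followed by the forward link
    -- to bead i+1, whose last vertex is left for segment i+1.
    segment : ℕ → ℕ → Vertex
    segment i k with k ≤? β i
    ... | yes _ = HW.at i (crossing i) k
    ... | no _  = pv (F i) (k ∸ β i)

    segment-crossing : ∀ i {k} → k ≤ β i → segment i k ≡ HW.at i (crossing i) k
    segment-crossing i {k} k≤β with k ≤? β i
    ... | yes _   = refl
    ... | no  k≰b = ⊥-elim (k≰b k≤β)

    segment-link : ∀ i {k} → β i ≤ k → segment i k ≡ pv (F i) (k ∸ β i)
    segment-link i {k} β≤k with k ≤? β i
    ... | no _ = refl
    ... | yes k≤β with ≤-antisym k≤β β≤k
    ...   | refl = trans (HW.at-end i (crossing i) ≤-refl) (cong (pv (F i)) (sym (n∸n≡0 k)))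

    link-index< : ∀ i {k} → β i ≤ k → k < L i → k ∸ β i < ℓ i
    link-index< i {k} β≤k k<L = subst (k ∸ β i <_) (m+n∸m≡n (β i) (ℓ i)) (∸-monoˡ-< k<L β≤k)

    segment-bead : ∀ i {k} → k ≤ β i → segment i k ∈ bead i
    segment-bead i k≤β = subst (_∈ bead i) (sym (segment-crossing i k≤β)) (crossing∈bead i _)

    segment-inner : ∀ i {k} → β i < k → k < L i → Inner D (F i) (segment i k)
    segment-inner i {k} β<k k<L =
      k ∸ β i , m<n⇒0<n∸m β<k , link-index< i (<⇒≤ β<k) k<L , sym (segment-link i (<⇒≤ β<k))

    segment-start : ∀ i → segment i 0 ≡ entry i
    segment-start i = trans (segment-crossing i z≤n) (HW.at-start i (crossing i))

    segment-end : ∀ i → segment i (L i) ≡ entry (suc i)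
    segment-end i = trans (segment-link i (m≤m+n (β i) (ℓ i))) (cong (pv (F i)) (m+n∸m≡n (β i) (ℓ i)))

    segment-edge : ∀ i {k} → k < L i → segment i k ⇒ segment i (suc k)
    segment-edge i {k} k<L with β i ≤? k
    ... | no  β≰k = subst₂ _⇒_ (sym (segment-crossing i (<⇒≤ k<β))) (sym (segment-crossing i k<β))
                      (proj₂ (proj₂ (H-sub i _ _ (HW.at-edge i (crossing i) k<β))))
      where k<β = ≰⇒> β≰k
    ... | yes β≤k = subst₂ _⇒_ (sym (segment-link i β≤k))
                      (sym (trans (segment-link i (m≤n⇒m≤1+n β≤k)) (cong (pv (F i)) (+-∸-assoc 1 β≤k))))
                      (DPath.edge (F i) (k ∸ β i) (link-index< i β≤k k<L))

    segment-injective : ∀ {i j k l} → k < L i → l < L j → segment i k ≡ segment j l → (i , k) ≡ (j , l)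
    segment-injective {i} {j} {k} {l} k<L l<L eq with β i <? k | β j <? l
    ... | no β≮k | yes β<l = ⊥-elim (innerBeads j true _
            (subst (Inner D (F j)) (sym eq) (segment-inner j β<l l<L)) i (segment-bead i (≮⇒≥ β≮k)))
    ... | yes β<k | no β≮l = ⊥-elim (innerBeads i true _ (segment-inner i β<k k<L) j
            (subst (_∈ bead j) (sym eq) (segment-bead j (≮⇒≥ β≮l))))
    ... | no β≮k | no β≮l with i ≟ j
    ...   | no i≢j = ⊥-elim (disjoint i j i≢j _ (segment-bead i (≮⇒≥ β≮k))
                       (subst (_∈ bead j) (sym eq) (segment-bead j (≮⇒≥ β≮l))))
    ...   | yes refl = cong (i ,_) (crossing-simple i k l (≮⇒≥ β≮k) (≮⇒≥ β≮l) (begin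
            HW.at i (crossing i) k ≡⟨ sym (segment-crossing i (≮⇒≥ β≮k)) ⟩
            segment i k            ≡⟨ eq ⟩
            segment i l            ≡⟨ segment-crossing i (≮⇒≥ β≮l) ⟩
            HW.at i (crossing i) l ∎))
      where open ≡-Reasoning
    segment-injective {i} {j} {k} {l} k<L l<L eq | yes β<k | yes β<l with i ≟ j
    ... | no i≢j = ⊥-elim (innerDisj i true j true (i≢j ∘ cong proj₁) _ (segment-inner i β<k k<L)
                     (subst (Inner D (F j)) (sym eq) (segment-inner j β<l l<L)))
    ... | yes refl = cong (i ,_) (∸-cancelʳ-≡ (<⇒≤ β<k) (<⇒≤ β<l) (DPath.inj (F i) _ _
                       (<⇒≤ (link-index< i (<⇒≤ β<k) k<L)) (<⇒≤ (link-index< i (<⇒≤ β<l) l<L)) (begin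
            pv (F i) (k ∸ β i) ≡⟨ sym (segment-link i (<⇒≤ β<k)) ⟩
            segment i k        ≡⟨ eq ⟩
            segment i l        ≡⟨ segment-link i (<⇒≤ β<l) ⟩
            pv (F i) (l ∸ β i) ∎)))
      where open ≡-Reasoning

    private
      0<L : ∀ i → 0 < L i
      0<L i = <-≤-trans (0<ℓ i) (m≤n+m (ℓ i) (β i))

    open Concatenation L 0<L

    vertex : ℕ → Vertex
    vertex n = segment (proj₁ (position n)) (proj₂ (position n))

    segment-next : ∀ {i k p} → k < L i → NextCase i k p → segment i k ⇒ segment (proj₁ p) (proj₂ p)
    segment-next k<L (within _) = segment-edge _ k<L
    segment-next {i} {k} k<L (wrap 1+k≡L) = subst (segment i k ⇒_) (begin
      segment i (suc k)  ≡⟨ cong (segment i) 1+k≡L ⟩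
      segment i (L i)    ≡⟨ segment-end i ⟩
      entry (suc i)      ≡⟨ sym (segment-start (suc i)) ⟩
      segment (suc i) 0  ∎) (segment-edge i k<L)
      where open ≡-Reasoning

    ray : Ray D
    ray = record
      { vtx  = vertex
      ; inj  = λ m n eq → position-injective (segment-injective (position-valid m) (position-valid n) eq)
      ; edge = λ n → segment-next (position-valid n) (position-suc n)
      }

    link-start : ∀ i c → pv (link i c) 0 ∈ bead i ⊎ pv (link i c) 0 ∈ bead (suc i)
    link-start i true  = inj₁ (proj₁ (fwd i))
    link-start i false = inj₂ (proj₁ (bwd i))

    link-end : ∀ i c → pv (link i c) (len (link i c)) ∈ bead i ⊎ pv (link i c) (len (link i c)) ∈ bead (suc i)
    link-end i true  = inj₂ (proj₁ (proj₂ (fwd i)))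
    link-end i false = inj₁ (proj₁ (proj₂ (bwd i)))

    eventually-∉bead : ∀ x → Eventually (λ i → x ∉ bead i)
    eventually-∉bead x with em {∃[ j ] x ∈ bead j}
    ... | yes (j , x∈j) = suc j , λ i j<i x∈i → disjoint j i (<⇒≢ j<i) x x∈j x∈i
    ... | no  ∄j        = 0 , λ i _ x∈i → ∄j (i , x∈i)

    eventually-∉inner : ∀ x → Eventually (λ i → ∀ c → ¬ Inner D (link i c) x)
    eventually-∉inner x with em {∃[ j ] ∃[ c ] Inner D (link j c) x}
    ... | yes (j , c , inner-j) =
          suc j , λ i j<i c′ inner-i → innerDisj j c i c′ (<⇒≢ j<i ∘ cong proj₁) x inner-j inner-i
    ... | no ∄j = 0 , λ i _ c inner → ∄j (i , c , inner)

    module Beyond (X : FinSet D) where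
      private
        clear = eventually-∀∈ (λ x → eventually-× (eventually-∉bead x) (eventually-∉inner x)) X

      n₀ : ℕ
      n₀ = proj₁ clear

      bead∉X : ∀ {i v} → n₀ ≤ i → v ∈ bead i → v ∉ X
      bead∉X {i} n₀≤i v∈bead v∈X = proj₁ (proj₂ clear i n₀≤i v∈X) v∈bead

      inner∉X : ∀ {i c v} → n₀ ≤ i → Inner D (link i c) v → v ∉ X
      inner∉X {i} {c} n₀≤i inner v∈X = proj₂ (proj₂ clear i n₀≤i v∈X) c inner

      adjacent∉X : ∀ {i v} → n₀ ≤ i → v ∈ bead i ⊎ v ∈ bead (suc i) → v ∉ X
      adjacent∉X n₀≤i (inj₁ v∈bead) = bead∉X n₀≤i v∈bead
      adjacent∉X n₀≤i (inj₂ v∈bead) = bead∉X (m≤n⇒m≤1+n n₀≤i) v∈bead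

      link∉X : ∀ {i} c → n₀ ≤ i → ∀ k → k ≤ len (link i c) → pv (link i c) k ∉ X
      link∉X c n₀≤i zero _ = adjacent∉X n₀≤i (link-start _ c)
      link∉X {i} c n₀≤i (suc k) k<len with suc k ≟ len (link i c)
      ... | yes eq = subst (λ j → pv (link i c) j ∉ X) (sym eq) (adjacent∉X n₀≤i (link-end i c))
      ... | no  ne = inner∉X n₀≤i (suc k , s≤s z≤n , ≤∧≢⇒< k<len ne , refl)

      bead-reach : ∀ {i u v} → n₀ ≤ i → u ∈ bead i → v ∈ bead i → Reach D X u v
      bead-reach {i} n₀≤i u∈bead v∈bead = lift (H-strong i _ _ u∈bead v∈bead) u∈bead
        where
        lift : ∀ {u v} → ReachIn D (H i) u v → u ∈ bead i → Reach D X u v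
        lift here       u∈bead = here (bead∉X n₀≤i u∈bead)
        lift (step h w) u∈bead = let (_ , w∈bead , e) = H-sub i _ _ h in
          step (bead∉X n₀≤i u∈bead) e (lift w w∈bead)

      link-reach : ∀ {i} c → n₀ ≤ i → Reach D X (pv (link i c) 0) (pv (link i c) (len (link i c)))
      link-reach {i} c n₀≤i = dpath-reach (link i c) _ z≤n ≤-refl λ k _ k≤len → link∉X c n₀≤i k k≤len

      next-bead-reach : ∀ {i u v} → n₀ ≤ i → u ∈ bead i → v ∈ bead (suc i) →
                        Reach D X u v × Reach D X v u
      next-bead-reach {i} n₀≤i u∈bead v∈bead =
        reach-trans (bead-reach n₀≤i u∈bead (proj₁ (fwd i)))
          (reach-trans (link-reach true n₀≤i) (bead-reach n₀≤1+i (proj₁ (proj₂ (fwd i))) v∈bead)) ,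
        reach-trans (bead-reach n₀≤1+i v∈bead (proj₁ (bwd i)))
          (reach-trans (link-reach false n₀≤i) (bead-reach n₀≤i (proj₁ (proj₂ (bwd i))) u∈bead))
        where n₀≤1+i = m≤n⇒m≤1+n n₀≤i

      a : Vertex
      a = entry n₀

      a∉X : a ∉ X
      a∉X = bead∉X ≤-refl (entry∈bead n₀)

      C : VSet D
      C = componentOf X a

      bead⊆C : ∀ d {v} → v ∈ bead (d + n₀) → C v
      bead⊆C zero v∈bead = bead-reach ≤-refl (entry∈bead n₀) v∈bead , bead-reach ≤-refl v∈bead (entry∈bead n₀)
      bead⊆C (suc d) v∈bead
        with bead⊆C d (entry∈bead (d + n₀)) | next-bead-reach (m≤n+m n₀ d) (entry∈bead (d + n₀)) v∈bead
      ... | a→w , w→a | w→v , v→w = reach-trans a→w w→v , reach-trans v→w w→a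

      beads⊆C : ∀ {i v} → n₀ ≤ i → v ∈ bead i → C v
      beads⊆C {i} n₀≤i v∈bead = bead⊆C (i ∸ n₀) (subst (λ j → _ ∈ bead j) (sym (m∸n+n≡m n₀≤i)) v∈bead)

      segment⊆C : ∀ {i k} → n₀ ≤ i → k < L i → C (segment i k)
      segment⊆C {i} {k} n₀≤i k<L with β i <? k
      ... | no  β≮k = beads⊆C n₀≤i (segment-bead i (≮⇒≥ β≮k))
      ... | yes β<k = subst C (sym (segment-link i (<⇒≤ β<k)))
                        (reach-trans a→exit exit→v , reach-trans v→entry entry→a)
        where
        m<ℓ = link-index< i (<⇒≤ β<k) k<L
        avoid : ∀ j → j ≤ ℓ i → pv (F i) j ∉ X
        avoid = link∉X true n₀≤i
        a→exit = proj₁ (beads⊆C n₀≤i (exit∈bead i))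
        exit→v = dpath-reach (F i) (k ∸ β i) z≤n (<⇒≤ m<ℓ) λ j _ j≤m → avoid j (≤-trans j≤m (<⇒≤ m<ℓ))
        v→entry = dpath-reach (F i) (ℓ i) (<⇒≤ m<ℓ) ≤-refl λ j _ j≤ℓ → avoid j j≤ℓ
        entry→a = proj₂ (beads⊆C (m≤n⇒m≤1+n n₀≤i) (entry∈bead (suc i)))

      tail⊆C : TailIn D ray (offset n₀) C
      tail⊆C n offset≤n = segment⊆C (offset≤⇒≤position n₀ n offset≤n) (position-valid n)

    ray-solid : Solid D ray
    ray-solid X = C , componentOf-strong a∉X , offset n₀ , tail⊆C
      where open Beyond X

    ray-closure : ∀ X C′ → IsStrongComponent D X C′ → HasTailIn D ray C′ → MeetsAll D 𝒰 C′
    ray-closure X C′ C′-strong (t , tail′) = meetsAll-mono bead⊆C′ (proj₂ (proj₂ (N-attached n₀)))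
      where
      open Beyond X
      r = t ⊔ offset n₀
      bead⊆C′ : ∀ {v} → v ∈ bead (proj₁ (N-attached n₀)) → C′ v
      bead⊆C′ v∈bead = strongComponent-⊇ (λ _ x∈ → x∈) C′-strong (componentOf-strong a∉X)
        (tail′ r (m≤m⊔n t _)) (tail⊆C r (m≤n⊔m t _)) _ (beads⊆C (proj₁ (proj₂ (N-attached n₀))) v∈bead)

  necklace⇒end : ∀ {𝒰} → HasAttachedNecklace D 𝒰 → EndInClosure D 𝒰
  necklace⇒end {𝒰} (N , N-attached) = ray , ray-solid , ray-closure
    where open NecklaceToEnd 𝒰 N N-attached

lemma4p2 : (∀ {ℓ} → ExcludedMiddle ℓ) →
           (D : Digraph) (𝒰 : List (VSet D)) →
           (EndInClosure D 𝒰 ⇔ VDInClosure D 𝒰) ×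
           (VDInClosure D 𝒰 ⇔ HasAttachedNecklace D 𝒰)
lemma4p2 em D 𝒰 =
  mk⇔ end⇒direction (necklace⇒end ∘ direction⇒necklace) ,
  mk⇔ direction⇒necklace (end⇒direction ∘ necklace⇒end)
  where open Development em D
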